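{- Let $n \geq 2$ and let $x = x_1\cdots x_n$ and $y = y_1 \cdots y_n$ be adjacent vertices of $LTQ_n$, and let $i \in \{1,2\}$. Then $x^{\varepsilon_i}$ and $y^{\zeta_i}$ are adjacent vertices of $LTQ_{n+1}$, and $$\mathrm{Dim}(x^{\varepsilon_i}, y^{\zeta_i}) = \begin{cases} \mathrm{Dim}(x,y), & \text{if } \mathrm{Dim}(x,y) \le n-1,\\ n+1, & \text{if } \mathrm{Dim}(x,y) = n.\end{cases}$$
   Context: The $n$-dimensional locally twisted cube $LTQ_n$ ($n \geq 2$) is the graph defined recursively as follows. Its vertices are the binary strings $x_1x_2\cdots x_n$ of length $n$. $LTQ_2$ is the 4-cycle $Q_2$ on $\{00,01,10,11\}$ (two strings adjacent iff they differ in exactly one bit). For $n \geq 3$, $LTQ_n$ is obtained from two disjoint copies of $LTQ_{n-1}$: one copy obtained by prefixing every vertex label with $0$, the other by prefixing every vertex label with $1$ (edges inside each copy are kept), and additionally each vertex $0x_2x_3\cdots x_n$ is joined to the vertex $1(x_2+x_n)x_3\cdots x_n$, where $+$ denotes addition modulo 2. For distinct vertices $x, y$, $\lambda(x,y)$ denotes the smallest index $i$ with $x_i \neq y_i$, and $\mathrm{Dim}(x,y) = \lambda(x,y)$ if $x$ and $y$ are adjacent, $\mathrm{Dim}(x,y) = \infty$ otherwise. For a vertex $x = x_1\cdots x_n$ of $LTQ_n$ and $\delta \in \{0,1\}$, $x^\delta$ denotes the vertex $x_1x_2\cdots x_{n-1}\,\delta\, x_n$ of $LTQ_{n+1}$ (the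 bit $\delta$ inserted before the last bit). For adjacent vertices $x, y$ of $LTQ_n$, the numbers $\varepsilon_i = \varepsilon_i(x,y)$, $\zeta_i = \zeta_i(x,y) \in \{0,1\}$ ($i = 1,2$) are chosen so that $\{(\varepsilon_1,\zeta_1),(\varepsilon_2,\zeta_2)\} = \{(0,1),(1,0)\}$ if $\mathrm{Dim}(x,y) = n-1$ and $x_n = 1$, and $\{(\varepsilon_1,\zeta_1),(\varepsilon_2,\zeta_2)\} = \{(0,0),(1,1)\}$ otherwise. -}

module Defs where

open import Data.Nat using (ℕ; zero; suc)
open import Data.Bool using (Bool; true; false; not; _∧_; _∨_; if_then_else_; _xor_)
open import Data.Vec using (Vec; []; _∷_)
open import Data.Maybe using (Maybe; just; nothing)

-- Vertices of LTQ_n: Vec Bool n, head = x_1, last = x_n; false = 0, true = 1.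

eqB : Bool → Bool → Bool
eqB a b = not (a xor b)

eqV : ∀ {n} → Vec Bool n → Vec Bool n → Bool
eqV [] [] = true
eqV (a ∷ xs) (b ∷ ys) = eqB a b ∧ eqV xs ys

-- last bit x_n (only used for n ≥ 1)
lastB : ∀ {n} → Vec Bool n → Bool
lastB [] = false
lastB (a ∷ []) = a
lastB (a ∷ b ∷ xs) = lastB (b ∷ xs)

twist : ∀ {n} → Vec Bool n → Vec Bool n
twist [] = []
twist (a ∷ xs) = (a xor lastB (a ∷ xs)) ∷ xs

ltqAdj : (n : ℕ) → Vec Bool n → Vec Bool n → Bool
ltqAdj zero _ _ = false
ltqAdj (suc zero) _ _ = false
ltqAdj (suc (suc zero)) (a ∷ b ∷ []) (c ∷ d ∷ []) =
  (eqB a c ∧ not (eqB b d)) ∨ (not (eqB a c) ∧ eqB b d)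
ltqAdj (suc (suc (suc n))) (a ∷ xs) (c ∷ ys) =
  (eqB a c ∧ ltqAdj (suc (suc n)) xs ys)
  ∨ (not (eqB a c) ∧ (if a then eqV xs (twist ys) else eqV ys (twist xs)))

-- λ(x,y): smallest (1-based) index i with x_i ≠ y_i (0 if x = y; never used then)
lam : ∀ {n} → Vec Bool n → Vec Bool n → ℕ
lam [] [] = zero
lam (a ∷ xs) (b ∷ ys) = if eqB a b then suc (lam xs ys) else suc zero

-- Dim(x,y) = λ(x,y) if adjacent, ∞ (= nothing) otherwise
Dim : (n : ℕ) → Vec Bool n → Vec Bool n → Maybe ℕ
Dim n x y = if ltqAdj n x y then just (lam x y) else nothing

-- x^δ : insert δ before the last bit
ins : ∀ {n} → Bool → Vec Bool n → Vec Bool (suc n)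
ins δ [] = δ ∷ []
ins δ (a ∷ []) = δ ∷ a ∷ []
ins δ (a ∷ b ∷ xs) = a ∷ ins δ (b ∷ xs)

open import Data.Product using (_×_; _,_)
open import Data.Sum using (_⊎_)
open import Relation.Binary.PropositionalEquality using (_≡_)
open import Relation.Nullary using (¬_)
open import Data.Nat using (_∸_)

SpecialEdge : (n : ℕ) → Vec Bool n → Vec Bool n → Set
SpecialEdge n x y = Dim n x y ≡ just (n ∸ 1) × lastB x ≡ true

PairSetEq : (Bool × Bool) → (Bool × Bool) → (Bool × Bool) → (Bool × Bool) → Set
PairSetEq u v p q = (u ≡ p × v ≡ q) ⊎ (u ≡ q × v ≡ p)

EpsZeta : (n : ℕ) → Vec Bool n → Vec Bool n → (ε₁ ζ₁ ε₂ ζ₂ : Bool) → Set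
EpsZeta n x y ε₁ ζ₁ ε₂ ζ₂ =
  (SpecialEdge n x y × PairSetEq (ε₁ , ζ₁) (ε₂ , ζ₂) (false , true) (true , false))
  ⊎ (¬ SpecialEdge n x y × PairSetEq (ε₁ , ζ₁) (ε₂ , ζ₂) (false , false) (true , true))

-- select (ε_i, ζ_i) for i ∈ {1,2} (Fin 2: zero ↦ 1, suc zero ↦ 2)
open import Data.Fin using (Fin) renaming (zero to fz; suc to fs)
sel : Fin 2 → (Bool × Bool) → (Bool × Bool) → (Bool × Bool)
sel fz p q = p
sel (fs _) p q = q

module Submission where

-- The admissible choices
-- of (ε_i, ζ_i) are exactly the pairs (ε, ε + s), where s is the bit
-- `special n x y` recording whether Dim(x,y) = n-1 and x_n = 1
-- (lemma admissible-ζ).  So it suffices to show (lemma liftEdge) that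
-- x^ε ~ y^(ε+s) in LTQ_{n+1} and that λ(x^ε, y^(ε+s)) = liftedDim n λ(x,y),
-- where liftedDim n d is n+1 when d = n and d otherwise.  The proof of
-- liftEdge follows the recursive definition of LTQ: dimension 2 is a finite
-- check (liftEdge₂); an edge inside a half of LTQ_{n+1} is lifted by
-- induction; and for a crossing edge x_1 ≠ y_1 one has s = 0, and inserting
-- the same bit into both ends commutes with the twist map (crossEdge-ins).

open import Defs
open import Data.Nat using (ℕ; zero; suc; _≤_; _<_; _∸_; _≡ᵇ_; s≤s)
open import Data.Nat.Properties using (≡ᵇ⇒≡; ≡⇒≡ᵇ)
open import Data.Bool using (Bool; true; false; not; T; _∧_; _∨_; _xor_)
open import Data.Bool.Properties using (∨-identityʳ; ¬-not; T-≡; T-∧; if-cong)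
open import Data.Vec using (Vec; []; _∷_)
open import Data.Fin using (Fin) renaming (zero to fz; suc to fs)
open import Data.Maybe using (just)
open import Data.Maybe.Properties using (just-injective)
open import Data.Product using (_×_; _,_)
open import Data.Sum using (inj₁; inj₂)
open import Function using (_∘_)
open import Function.Bundles using (Equivalence)
open import Relation.Binary.PropositionalEquality using (_≡_; refl; sym; trans; cong; subst)
open import Relation.Binary.PropositionalEquality.Properties using (module ≡-Reasoning)

open Equivalence using (to; from)
open ≡-Reasoning

lastB-ins : ∀ {n} (δ : Bool) (v : Vec Bool (suc n)) → lastB (ins δ v) ≡ lastB v
lastB-ins δ (a ∷ []) = refl
lastB-ins δ (a ∷ b ∷ v) = trans (lastB-cons (ins δ (b ∷ v))) (lastB-ins δ (b ∷ v))
  where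
  lastB-cons : ∀ {k} (w : Vec Bool (suc k)) → lastB (a ∷ w) ≡ lastB w
  lastB-cons (c ∷ w) = refl

twist-ins : ∀ {n} (δ : Bool) (v : Vec Bool (suc (suc n))) → twist (ins δ v) ≡ ins δ (twist v)
twist-ins δ (a ∷ b ∷ v) = cong (λ l → (a xor l) ∷ ins δ (b ∷ v)) (lastB-ins δ (a ∷ b ∷ v))

eqV-ins : ∀ {n} (δ : Bool) (u w : Vec Bool (suc n)) → eqV (ins δ u) (ins δ w) ≡ eqV u w
eqV-ins false (a ∷ []) (c ∷ []) = refl
eqV-ins true  (a ∷ []) (c ∷ []) = refl
eqV-ins δ (a ∷ b ∷ u) (c ∷ d ∷ w) = cong (eqB a c ∧_) (eqV-ins δ (b ∷ u) (d ∷ w))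

crossEdge-ins : ∀ {n} (δ : Bool) (u w : Vec Bool (suc (suc n))) →
  eqV (ins δ u) (twist (ins δ w)) ≡ eqV u (twist w)
crossEdge-ins δ u w = trans (cong (eqV (ins δ u)) (twist-ins δ w)) (eqV-ins δ u (twist w))

special : (n : ℕ) → Vec Bool n → Vec Bool n → Bool
special n x y = (lam x y ≡ᵇ n ∸ 1) ∧ lastB x

liftedDim : ℕ → ℕ → ℕ
liftedDim zero    zero    = 1
liftedDim zero    (suc d) = suc d
liftedDim (suc n) zero    = zero
liftedDim (suc n) (suc d) = suc (liftedDim n d)

liftedDim-top : ∀ n → liftedDim n n ≡ suc n
liftedDim-top zero    = refl
liftedDim-top (suc n) = cong suc (liftedDim-top n)

liftedDim-below : ∀ {n d} → d < n → liftedDim n d ≡ d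
liftedDim-below {suc n} {zero}  _           = refl
liftedDim-below {suc n} {suc d} (s≤s d<n) = cong suc (liftedDim-below d<n)

Lifts : (n : ℕ) → Vec Bool n → Vec Bool n → Bool → Set
Lifts n x y ε =
  T (ltqAdj (suc n) (ins ε x) (ins ζ y)) × lam (ins ε x) (ins ζ y) ≡ liftedDim n (lam x y)
  where ζ = ε xor special n x y

liftEdge₂ : (x y : Vec Bool 2) (ε : Bool) → T (ltqAdj 2 x y) → Lifts 2 x y ε
liftEdge₂ (false ∷ false ∷ []) (false ∷ true  ∷ []) false _ = _ , refl
liftEdge₂ (false ∷ false ∷ []) (false ∷ true  ∷ []) true  _ = _ , refl
liftEdge₂ (false ∷ false ∷ []) (true  ∷ false ∷ []) false _ = _ , refl
liftEdge₂ (false ∷ false ∷ []) (true  ∷ false ∷ []) true  _ = _ , refl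
liftEdge₂ (false ∷ true  ∷ []) (false ∷ false ∷ []) false _ = _ , refl
liftEdge₂ (false ∷ true  ∷ []) (false ∷ false ∷ []) true  _ = _ , refl
liftEdge₂ (false ∷ true  ∷ []) (true  ∷ true  ∷ []) false _ = _ , refl
liftEdge₂ (false ∷ true  ∷ []) (true  ∷ true  ∷ []) true  _ = _ , refl
liftEdge₂ (true  ∷ false ∷ []) (false ∷ false ∷ []) false _ = _ , refl
liftEdge₂ (true  ∷ false ∷ []) (false ∷ false ∷ []) true  _ = _ , refl
liftEdge₂ (true  ∷ false ∷ []) (true  ∷ true  ∷ []) false _ = _ , refl
liftEdge₂ (true  ∷ false ∷ []) (true  ∷ true  ∷ []) true  _ = _ , refl
liftEdge₂ (true  ∷ true  ∷ []) (false ∷ true  ∷ []) false _ = _ , refl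
liftEdge₂ (true  ∷ true  ∷ []) (false ∷ true  ∷ []) true  _ = _ , refl
liftEdge₂ (true  ∷ true  ∷ []) (true  ∷ false ∷ []) false _ = _ , refl
liftEdge₂ (true  ∷ true  ∷ []) (true  ∷ false ∷ []) true  _ = _ , refl
liftEdge₂ (false ∷ false ∷ []) (false ∷ false ∷ []) _ ()
liftEdge₂ (false ∷ false ∷ []) (true  ∷ true  ∷ []) _ ()
liftEdge₂ (false ∷ true  ∷ []) (false ∷ true  ∷ []) _ ()
liftEdge₂ (false ∷ true  ∷ []) (true  ∷ false ∷ []) _ ()
liftEdge₂ (true  ∷ false ∷ []) (false ∷ true  ∷ []) _ ()
liftEdge₂ (true  ∷ false ∷ []) (true  ∷ false ∷ []) _ ()
liftEdge₂ (true  ∷ true  ∷ []) (false ∷ false ∷ []) _ ()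
liftEdge₂ (true  ∷ true  ∷ []) (true  ∷ true  ∷ []) _ ()

-- Within one half of LTQ_{n+1} (x_1 = y_1) adjacency is that of LTQ_n.
insideHalf : ∀ {b} → T (b ∨ false) → T b
insideHalf = subst T (∨-identityʳ _)

-- An edge lifted inside a half gains the common first bit: λ increases by one.
liftInsideHalf : ∀ {b d e} → T b × d ≡ e → T (b ∨ false) × suc d ≡ suc e
liftInsideHalf (adj , dim) = subst T (sym (∨-identityʳ _)) adj , cong suc dim

-- Edge lifting in every dimension n ≥ 2.  For crossing edges s = 0 and λ = 1.
liftEdge : ∀ m (x y : Vec Bool (suc (suc m))) (ε : Bool) →
  T (ltqAdj (suc (suc m)) x y) → Lifts (suc (suc m)) x y ε
liftEdge zero x y ε adj = liftEdge₂ x y ε adj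
liftEdge (suc k) (true ∷ x@(_ ∷ _)) (true ∷ y@(_ ∷ _)) ε adj =
  liftInsideHalf (liftEdge k x y ε (insideHalf adj))
liftEdge (suc k) (false ∷ x@(_ ∷ _)) (false ∷ y@(_ ∷ _)) ε adj =
  liftInsideHalf (liftEdge k x y ε (insideHalf adj))
liftEdge (suc k) (true ∷ x@(_ ∷ _)) (false ∷ y@(_ ∷ _)) false adj =
  subst T (sym (crossEdge-ins false x y)) adj , refl
liftEdge (suc k) (true ∷ x@(_ ∷ _)) (false ∷ y@(_ ∷ _)) true adj =
  subst T (sym (crossEdge-ins true x y)) adj , refl
liftEdge (suc k) (false ∷ x@(_ ∷ _)) (true ∷ y@(_ ∷ _)) false adj =
  subst T (sym (crossEdge-ins false y x)) adj , refl
liftEdge (suc k) (false ∷ x@(_ ∷ _)) (true ∷ y@(_ ∷ _)) true adj =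
  subst T (sym (crossEdge-ins true y x)) adj , refl

Dim-adjacent : ∀ n (x y : Vec Bool n) → T (ltqAdj n x y) → Dim n x y ≡ just (lam x y)
Dim-adjacent n x y adj = if-cong (to T-≡ adj)

lam-of-Dim : ∀ n (x y : Vec Bool n) {d} → T (ltqAdj n x y) → Dim n x y ≡ just d → lam x y ≡ d
lam-of-Dim n x y adj dim = just-injective (trans (sym (Dim-adjacent n x y adj)) dim)

SpecialEdge⇒special : ∀ n (x y : Vec Bool n) → T (ltqAdj n x y) →
  SpecialEdge n x y → special n x y ≡ true
SpecialEdge⇒special n x y adj (dim , last)
  rewrite lam-of-Dim n x y adj dim =
    to T-≡ (from T-∧ (≡⇒≡ᵇ (n ∸ 1) (n ∸ 1) refl , from T-≡ last))

special⇒SpecialEdge : ∀ n (x y : Vec Bool n) → T (ltqAdj n x y) →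
  special n x y ≡ true → SpecialEdge n x y
special⇒SpecialEdge n x y adj s with to T-∧ (from T-≡ s)
... | λ≡ , last =
  trans (Dim-adjacent n x y adj) (cong just (≡ᵇ⇒≡ (lam x y) (n ∸ 1) λ≡)) , to T-≡ last

sel-xor : ∀ s {ε₁ ζ₁ ε₂ ζ₂ ε ζ} (i : Fin 2) →
  PairSetEq (ε₁ , ζ₁) (ε₂ , ζ₂) (false , s) (true , not s) →
  sel i (ε₁ , ζ₁) (ε₂ , ζ₂) ≡ (ε , ζ) → ζ ≡ ε xor s
sel-xor s fz     (inj₁ (refl , refl)) refl = refl
sel-xor s (fs _) (inj₁ (refl , refl)) refl = refl
sel-xor s fz     (inj₂ (refl , refl)) refl = refl
sel-xor s (fs _) (inj₂ (refl , refl)) refl = refl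

admissible-ζ : ∀ n (x y : Vec Bool n) → T (ltqAdj n x y) →
  ∀ {ε₁ ζ₁ ε₂ ζ₂} → EpsZeta n x y ε₁ ζ₁ ε₂ ζ₂ →
  ∀ (i : Fin 2) {ε ζ} → sel i (ε₁ , ζ₁) (ε₂ , ζ₂) ≡ (ε , ζ) → ζ ≡ ε xor special n x y
admissible-ζ n x y adj (inj₁ (isSpecial , choice)) i picked
  rewrite SpecialEdge⇒special n x y adj isSpecial = sel-xor true i choice picked
admissible-ζ n x y adj (inj₂ (notSpecial , choice)) i picked
  rewrite ¬-not (notSpecial ∘ special⇒SpecialEdge n x y adj) = sel-xor false i choice picked

mainTheorem7 : (n : ℕ) → 2 ≤ n → (x y : Vec Bool n) → T (ltqAdj n x y) →
    (ε₁ ζ₁ ε₂ ζ₂ : Bool) → EpsZeta n x y ε₁ ζ₁ ε₂ ζ₂ →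
    (i : Fin 2) → (ε ζ : Bool) → sel i (ε₁ , ζ₁) (ε₂ , ζ₂) ≡ (ε , ζ) →
    T (ltqAdj (suc n) (ins ε x) (ins ζ y))
    × ((d : ℕ) → Dim n x y ≡ just d → d ≤ n ∸ 1 → Dim (suc n) (ins ε x) (ins ζ y) ≡ just d)
    × (Dim n x y ≡ just n → Dim (suc n) (ins ε x) (ins ζ y) ≡ just (suc n))
-- Reduce to ζ = ε + s, lift the edge, and read off Dim from λ via liftedDim.
mainTheorem7 n@(suc (suc m)) _ x y adj _ _ _ _ choice i ε ζ picked
  with admissible-ζ n x y adj choice i picked
... | refl with liftEdge m x y ε adj
... | liftedAdj , liftedLam = liftedAdj , belowTop , atTop
  where
  liftedDimEq : Dim (suc n) (ins ε x) (ins ζ y) ≡ just (liftedDim n (lam x y))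
  liftedDimEq = trans (Dim-adjacent (suc n) (ins ε x) (ins ζ y) liftedAdj) (cong just liftedLam)

  belowTop : (d : ℕ) → Dim n x y ≡ just d → d ≤ n ∸ 1 → Dim (suc n) (ins ε x) (ins ζ y) ≡ just d
  belowTop d dim d≤n-1 = begin
    Dim (suc n) (ins ε x) (ins ζ y)   ≡⟨ liftedDimEq ⟩
    just (liftedDim n (lam x y))      ≡⟨ cong (just ∘ liftedDim n) (lam-of-Dim n x y adj dim) ⟩
    just (liftedDim n d)              ≡⟨ cong just (liftedDim-below (s≤s d≤n-1)) ⟩
    just d                            ∎

  atTop : Dim n x y ≡ just n → Dim (suc n) (ins ε x) (ins ζ y) ≡ just (suc n)
  atTop dim = begin
    Dim (suc n) (ins ε x) (ins ζ y)   ≡⟨ liftedDimEq ⟩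
    just (liftedDim n (lam x y))      ≡⟨ cong (just ∘ liftedDim n) (lam-of-Dim n x y adj dim) ⟩
    just (liftedDim n n)              ≡⟨ cong just (liftedDim-top n) ⟩
    just (suc n)                      ∎
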